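{- Let $\alpha=\log_2 3$ and $\beta=\frac{1+\alpha}{2}+\frac{1-\alpha}{10^6}$. For all sufficiently large $n$, with $k=\lfloor\log_2 n\rfloor$, \[\log_2\!\left(\frac{|B(n)|}{|F(n-k)|}\right)\le \beta n\log_2 n+n+\tfrac{3}{2}\log_2^2 n-\tfrac12\log_2 n,\] where $F(m)$ is the set of $I_3$-free digraphs on $\{0,\ldots,m-1\}$, $A(n)=\{\Gamma\in F(n):\exists v\in\Gamma\ (|\Delta(v)|\le\log_2 n)\}$, and $B(n)=\{\Gamma\in F(n)\setminus A(n): \exists v\in\Gamma\ \exists Q\subseteq\Delta(v)\ (|Q|=k\text{ and }|\Delta(Q)|\le(1/2-10^{ -6})n)\}$.
   Context: A digraph is a pair $(G,E)$ with $E\subseteq G\times G$ such that $(g,g)\notin E$ for all $g$, and $(g,g')\in E$ implies $(g',g)\notin E$; write $g\rightarrow g'$ for $(g,g')\in E$. It is $I_3$-free if every set of three distinct vertices spans at least one arrow. In a digraph, $x\not\sim y$ means $x\neq y$, $x\not\rightarrow y$ and $y\not\rightarrow x$; $\Delta(v)=\{x: x\not\sim v\}$; for a vertex set $Q$, $\Delta(Q)=\big(\bigcup_{u\in Q}\Delta(u)\big)\setminus Q$. Here $\log_2^2 n=(\log_2 n)^2$. -}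

module Defs where

open import Data.Bool using (Bool; true; false; _∧_; not)
import Data.Bool.Properties as BoolP
open import Data.Nat using (ℕ; zero; suc; _+_; _*_; _∸_; _^_; _≤_; _<_)
import Data.Nat.Properties as ℕP
open import Data.Integer using (ℤ; +_; -[1+_])
open import Data.Rational using (ℚ; ↥_; ↧ₙ_)
import Data.Rational as ℚ
open import Data.Fin using (Fin)
import Data.Fin.Properties as FinP
open import Data.Fin.Subset using (Subset; ∣_∣; _⊆_; inside)
open import Data.Fin.Subset.Properties using (anySubset?; _⊆?_)
open import Data.Vec using (Vec; []; _∷_; lookup; tabulate)
open import Data.List using (List; []; _∷_; concatMap; map; filter; length)
open import Data.Product using (Σ; ∃; ∃-syntax; _×_; _,_)
open import Data.Sum using (_⊎_)
open import Relation.Nullary using (¬_; Dec; does)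
open import Relation.Nullary.Decidable using (_×-dec_; _⊎-dec_; ¬?; _→-dec_)
open import Relation.Binary.PropositionalEquality using (_≡_; _≢_)

Matrix : ℕ → Set
Matrix m = Vec (Vec Bool m) m

Arr : ∀ {m} → Matrix m → Fin m → Fin m → Set
Arr M g g' = lookup (lookup M g) g' ≡ true

Arr? : ∀ {m} (M : Matrix m) g g' → Dec (Arr M g g')
Arr? M g g' = lookup (lookup M g) g' BoolP.≟ true

IsDigraph : ∀ {m} → Matrix m → Set
IsDigraph {m} M = (∀ g → ¬ Arr M g g) × (∀ g g' → Arr M g g' → ¬ Arr M g' g)

I3free : ∀ {m} → Matrix m → Set
I3free {m} M = ∀ (x y z : Fin m) → x ≢ y → x ≢ z → y ≢ z →
  (Arr M x y ⊎ Arr M y x) ⊎ ((Arr M x z ⊎ Arr M z x) ⊎ (Arr M y z ⊎ Arr M z y))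

NonAdj : ∀ {m} → Matrix m → Fin m → Fin m → Set
NonAdj M x y = x ≢ y × (¬ Arr M x y × ¬ Arr M y x)

NonAdj? : ∀ {m} (M : Matrix m) x y → Dec (NonAdj M x y)
NonAdj? M x y = ¬? (x FinP.≟ y) ×-dec (¬? (Arr? M x y) ×-dec ¬? (Arr? M y x))

Δ : ∀ {m} → Matrix m → Fin m → Subset m
Δ M v = tabulate (λ x → does (NonAdj? M x v))

ΔS : ∀ {m} → Matrix m → Subset m → Subset m
ΔS M Q = tabulate (λ x → not (lookup Q x) ∧
           does (FinP.any? (λ u → (lookup Q u BoolP.≟ true) ×-dec NonAdj? M x u)))

InF : ∀ {m} → Matrix m → Set
InF M = IsDigraph M × I3free M

-- ∃ v with |Δ(v)| ≤ log₂ n, i.e. 2^|Δ(v)| ≤ n (exact, since both sides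
-- of |Δ(v)| ≤ log₂ n are monotone images under x ↦ 2^x)
InA : ∀ {n} → Matrix n → Set
InA {n} M = InF M × ∃[ v ] (2 ^ ∣ Δ M v ∣ ≤ n)

-- Γ ∈ F(n) \ A(n), ∃ v ∃ Q ⊆ Δ(v), |Q| = k = ⌊log₂ n⌋ and
-- |Δ(Q)| ≤ (1/2 - 10⁻⁶) n, i.e. 10⁶ |Δ(Q)| ≤ 499999 n.
InB : ∀ {n} → ℕ → Matrix n → Set
InB {n} k M = (InF M × ¬ InA M) ×
  ∃[ v ] ∃[ Q ] ((Q ⊆ Δ M v × ∣ Q ∣ ≡ k) × 1000000 * ∣ ΔS M Q ∣ ≤ 499999 * n)

IsDigraph? : ∀ {m} (M : Matrix m) → Dec (IsDigraph M)
IsDigraph? M = FinP.all? (λ g → ¬? (Arr? M g g)) ×-dec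
  FinP.all? (λ g → FinP.all? (λ g' → Arr? M g g' →-dec ¬? (Arr? M g' g)))

I3free? : ∀ {m} (M : Matrix m) → Dec (I3free M)
I3free? M = FinP.all? λ x → FinP.all? λ y → FinP.all? λ z →
  ¬? (x FinP.≟ y) →-dec (¬? (x FinP.≟ z) →-dec (¬? (y FinP.≟ z) →-dec
  ((Arr? M x y ⊎-dec Arr? M y x) ⊎-dec
   ((Arr? M x z ⊎-dec Arr? M z x) ⊎-dec (Arr? M y z ⊎-dec Arr? M z y)))))

InF? : ∀ {m} (M : Matrix m) → Dec (InF M)
InF? M = IsDigraph? M ×-dec I3free? M

InA? : ∀ {n} (M : Matrix n) → Dec (InA M)
InA? {n} M = InF? M ×-dec FinP.any? (λ v → 2 ^ ∣ Δ M v ∣ ℕP.≤? n)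

InB? : ∀ {n} k (M : Matrix n) → Dec (InB k M)
InB? {n} k M = (InF? M ×-dec ¬? (InA? M)) ×-dec
  FinP.any? (λ v → anySubset? (λ Q →
    ((Q ⊆? Δ M v) ×-dec (∣ Q ∣ ℕP.≟ k)) ×-dec
    (1000000 * ∣ ΔS M Q ∣ ℕP.≤? 499999 * n)))

-- Counting: enumerate all matrices (each digraph on {0..m-1} is exactly
-- one matrix satisfying IsDigraph)

allVecs : ∀ {A : Set} → List A → (n : ℕ) → List (Vec A n)
allVecs xs zero = [] ∷ []
allVecs xs (suc n) = concatMap (λ x → map (x ∷_) (allVecs xs n)) xs

allMatrices : (m : ℕ) → List (Matrix m)
allMatrices m = allVecs (allVecs (true ∷ false ∷ []) m) m

#F : ℕ → ℕ
#F m = length (filter InF? (allMatrices m))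

#B : ℕ → ℕ → ℕ
#B n k = length (filter (InB? k) (allMatrices n))

-- Exact comparisons of rational powers of 2 with rationals of ℕ, for
-- q = p / d in lowest terms (d = ↧ₙ q ≥ 1):

-- 2^q < x / y   (i.e. q < log₂ (x/y)), for y > 0
Pow2< : ℚ → ℕ → ℕ → Set
Pow2< q x y with ↥ q
... | + p      = 2 ^ p * y ^ (↧ₙ q) < x ^ (↧ₙ q)
... | -[1+ p ] = y ^ (↧ₙ q) < x ^ (↧ₙ q) * 2 ^ suc p

-- x < 2^q   (i.e. log₂ x < q)
<Pow2 : ℕ → ℚ → Set
<Pow2 x q with ↥ q
... | + p      = x ^ (↧ₙ q) < 2 ^ p
... | -[1+ p ] = x ^ (↧ₙ q) * 2 ^ suc p < 1

ℕ→ℚ : ℕ → ℚ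
ℕ→ℚ n = + n ℚ./ 1

βof : ℚ → ℚ
βof a = (ℚ.1ℚ ℚ.+ a) ℚ.* ℚ.½ ℚ.+ (ℚ.1ℚ ℚ.- a) ℚ.* (+ 1 ℚ./ 1000000)

-- RHS(n, l, a) = β(a) n l + n + (3/2) l² - (1/2) l,
-- where l stands for log₂ n and a for α = log₂ 3
RHS : ℕ → ℚ → ℚ → ℚ
RHS n l a = βof a ℚ.* ℕ→ℚ n ℚ.* l ℚ.+ ℕ→ℚ n
  ℚ.+ (+ 3 ℚ./ 2) ℚ.* l ℚ.* l ℚ.- ℚ.½ ℚ.* l

-- log₂ (x / y) ≤ RHS(n, log₂ n, log₂ 3), expressed exactly through
-- rational approximations: every rational q below log₂(x/y) is ≤
-- RHS(n,l,a) for all rationals l > log₂ n and a > log₂ 3.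
-- (RHS is continuous and increasing in l, a on the relevant region, so
-- RHS(n, log₂ n, log₂ 3) = inf over such l, a.)
Log2RatioBound : ℕ → ℕ → ℕ → Set
Log2RatioBound n x y = ∀ (q l a : ℚ) → Pow2< q x y → <Pow2 n l → <Pow2 3 a →
  q ℚ.≤ RHS n l a

-- A digraph Γ ∈ B(n) is recovered from a short code: the witness set Q with |Q| = k (at most
-- n^k choices), the digraph induced on Q (2^(k²) choices), the I₃-free digraph induced on the
-- other n − k vertices (|F(n − k)| choices), the set S = Δ(Q) (2^(n−k) choices) and, for
-- every u ∈ Q and x ∉ Q, which of u → x, x → u or neither holds. A vertex x ∉ S is adjacent
-- to all of Q, so only two options remain for it; hence the last item has at most
-- (3^s 2^(n−k−s))^k choices, where s ≤ (1/2 − 10⁻⁶) n bounds |S|. Only |Q| = k and this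
-- bound on |Δ(Q)| are used, not Q ⊆ Δ(v) or Γ ∉ A(n). Taking logarithms with k ≤ log₂ n,
-- α = log₂ 3 and s ≤ (1/2 − 10⁻⁶) n gives
--   log₂ (|B(n)| / |F(n − k)|) ≤ k log₂ n + k² + (n − k) + k (s α + n − k − s) ≤ RHS.
-- The logarithms are irrational, so "log₂ c ≤ r" is handled through c^D ≤ 2^E with E ≤ r D.
module Submission where

open import Defs

module Enumeration where
  open import Data.Bool using (true; false)
  open import Data.Nat using (ℕ; zero; suc; _+_; _*_; _^_; _≤_; z≤n; s≤s)
  import Data.Nat.Properties as ℕP
  open import Data.Vec using (Vec; []; _∷_; lookup; replicate)
  import Data.Vec.Properties as VecP
  open import Data.Fin using (zero; suc)
  open import Data.Fin.Subset using (Subset)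
  open import Data.List using (List; []; _∷_; _++_; map; concatMap; length; cartesianProductWith)
  import Data.List.Properties as ListP
  open import Data.List.Membership.Propositional using (_∈_; _─_; lose)
  open import Data.List.Membership.Propositional.Properties using (∈-cartesianProductWith⁺; ∈-concatMap⁺)
  open import Data.List.Relation.Unary.Any using (here; there; index)
  import Data.List.Relation.Unary.All as All
  open import Data.List.Relation.Unary.All using ([]; _∷_)
  open import Data.List.Relation.Unary.AllPairs using ([]; _∷_)
  open import Data.List.Relation.Unary.Unique.Propositional using (Unique)
  import Data.List.Relation.Unary.Unique.Propositional.Properties as UniqueP
  open import Data.List.Relation.Binary.Subset.Propositional using (_⊆_)
  open import Data.Empty using (⊥-elim)
  open import Function using (_∘_)
  open import Relation.Binary.PropositionalEquality

  private variable
    A B C : Set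
    m n : ℕ

  length-cartesianProductWith : ∀ (f : A → B → C) xs ys →
    length (cartesianProductWith f xs ys) ≡ length xs * length ys
  length-cartesianProductWith f []       ys = refl
  length-cartesianProductWith f (x ∷ xs) ys = begin
    length (map (f x) ys ++ cartesianProductWith f xs ys)
      ≡⟨ ListP.length-++ (map (f x) ys) ⟩
    length (map (f x) ys) + length (cartesianProductWith f xs ys)
      ≡⟨ cong₂ _+_ (ListP.length-map (f x) ys) (length-cartesianProductWith f xs ys) ⟩
    length ys + length xs * length ys
      ∎
    where open ≡-Reasoning

  length-concatMap-≤ : ∀ (f : A → List B) c xs → (∀ {x} → x ∈ xs → length (f x) ≤ c) →
    length (concatMap f xs) ≤ length xs * c
  length-concatMap-≤ f c []       _     = z≤n
  length-concatMap-≤ f c (x ∷ xs) bound = begin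
    length (f x ++ concatMap f xs)          ≡⟨ ListP.length-++ (f x) ⟩
    length (f x) + length (concatMap f xs)  ≤⟨ ℕP.+-mono-≤ (bound (here refl))
                                                 (length-concatMap-≤ f c xs (bound ∘ there)) ⟩
    c + length xs * c                       ∎
    where open ℕP.≤-Reasoning

  ∈-concatMap : ∀ (f : A → List B) {x xs y} → x ∈ xs → y ∈ f x → y ∈ concatMap f xs
  ∈-concatMap f x∈xs y∈fx = ∈-concatMap⁺ f (lose x∈xs y∈fx)

  ∈-─ : ∀ {x y : A} {ys} (x∈ys : x ∈ ys) → y ∈ ys → y ≢ x → y ∈ ys ─ x∈ys
  ∈-─ (here refl)  (here refl)  y≢x = ⊥-elim (y≢x refl)
  ∈-─ (here refl)  (there y∈ys) _   = y∈ys
  ∈-─ (there _)    (here refl)  _   = here refl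
  ∈-─ (there x∈ys) (there y∈ys) y≢x = there (∈-─ x∈ys y∈ys y≢x)

  Unique-⊆⇒length-≤ : ∀ {xs ys : List A} → Unique xs → xs ⊆ ys → length xs ≤ length ys
  Unique-⊆⇒length-≤ {xs = []}     _             _   = z≤n
  Unique-⊆⇒length-≤ {xs = x ∷ xs} {ys} (x∉xs ∷ uniq) sub = begin
    suc (length xs)           ≤⟨ s≤s (Unique-⊆⇒length-≤ uniq sub′) ⟩
    suc (length (ys ─ x∈ys))  ≡⟨ ListP.length-removeAt′ ys (index x∈ys) ⟨
    length ys                 ∎
    where
    open ℕP.≤-Reasoning
    x∈ys = sub (here refl)
    sub′ : xs ⊆ ys ─ x∈ys
    sub′ y∈xs = ∈-─ x∈ys (sub (there y∈xs)) λ { refl → All.lookup x∉xs y∈xs refl }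

  allChoices : Vec (List A) n → List (Vec A n)
  allChoices []       = [] ∷ []
  allChoices (L ∷ Ls) = cartesianProductWith _∷_ L (allChoices Ls)

  ∈-allChoices : ∀ {Ls : Vec (List A) n} {v} → (∀ i → lookup v i ∈ lookup Ls i) → v ∈ allChoices Ls
  ∈-allChoices {Ls = []}     {[]}    _   = here refl
  ∈-allChoices {Ls = L ∷ Ls} {x ∷ v} mem =
    ∈-cartesianProductWith⁺ _∷_ (mem zero) (∈-allChoices {Ls = Ls} (mem ∘ suc))

  allChoices-unique : ∀ {Ls : Vec (List A) n} → (∀ i → Unique (lookup Ls i)) → Unique (allChoices Ls)
  allChoices-unique {Ls = []}     _    = [] ∷ []
  allChoices-unique {Ls = L ∷ Ls} uniq = UniqueP.cartesianProductWith⁺ _∷_ VecP.∷-injective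
    (uniq zero) (allChoices-unique {Ls = Ls} (uniq ∘ suc))

  concatMap-map≡cartesianProductWith : ∀ (f : A → B → C) xs ys →
    concatMap (λ x → map (f x) ys) xs ≡ cartesianProductWith f xs ys
  concatMap-map≡cartesianProductWith f []       ys = refl
  concatMap-map≡cartesianProductWith f (x ∷ xs) ys =
    cong (map (f x) ys ++_) (concatMap-map≡cartesianProductWith f xs ys)

  allVecs≡allChoices : ∀ (xs : List A) n → allVecs xs n ≡ allChoices (replicate n xs)
  allVecs≡allChoices xs zero    = refl
  allVecs≡allChoices xs (suc n) = begin
    concatMap (λ x → map (x ∷_) (allVecs xs n)) xs            ≡⟨ concatMap-map≡cartesianProductWith _∷_ xs _ ⟩
    cartesianProductWith _∷_ xs (allVecs xs n)                ≡⟨ cong (cartesianProductWith _∷_ xs)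
                                                                      (allVecs≡allChoices xs n) ⟩
    cartesianProductWith _∷_ xs (allChoices (replicate n xs)) ∎
    where open ≡-Reasoning

  ∈-allVecs : ∀ {xs : List A} {v : Vec A n} → (∀ i → lookup v i ∈ xs) → v ∈ allVecs xs n
  ∈-allVecs {xs = xs} {v} mem = subst (v ∈_) (sym (allVecs≡allChoices xs _))
    (∈-allChoices {Ls = replicate _ xs} λ i → subst (lookup v i ∈_) (sym (VecP.lookup-replicate i xs)) (mem i))

  allVecs-unique : ∀ {xs : List A} n → Unique xs → Unique (allVecs xs n)
  allVecs-unique {xs = xs} n uniq = subst Unique (sym (allVecs≡allChoices xs n))
    (allChoices-unique {Ls = replicate n xs} λ i → subst Unique (sym (VecP.lookup-replicate i xs)) uniq)

  length-allVecs : ∀ (xs : List A) n → length (allVecs xs n) ≡ length xs ^ n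
  length-allVecs xs zero    = refl
  length-allVecs xs (suc n) = begin
    length (allVecs xs (suc n))                         ≡⟨ cong length (concatMap-map≡cartesianProductWith _∷_ xs _) ⟩
    length (cartesianProductWith _∷_ xs (allVecs xs n)) ≡⟨ length-cartesianProductWith _∷_ xs _ ⟩
    length xs * length (allVecs xs n)                   ≡⟨ cong (length xs *_) (length-allVecs xs n) ⟩
    length xs * length xs ^ n                           ∎
    where open ≡-Reasoning

  allSubsets : (m : ℕ) → List (Subset m)
  allSubsets = allVecs (true ∷ false ∷ [])

  ∈-allSubsets : (S : Subset m) → S ∈ allSubsets m
  ∈-allSubsets S = ∈-allVecs λ i → bool∈ (lookup S i)
    where
    bool∈ : ∀ b → b ∈ true ∷ false ∷ []
    bool∈ true  = here refl
    bool∈ false = there (here refl)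

  ∈-allMatrices : (M : Matrix m) → M ∈ allMatrices m
  ∈-allMatrices M = ∈-allVecs λ i → ∈-allSubsets (lookup M i)

  allMatrices-unique : ∀ m → Unique (allMatrices m)
  allMatrices-unique m = allVecs-unique m (allVecs-unique m (((λ ()) ∷ []) ∷ [] ∷ []))

  length-allMatrices : ∀ m → length (allMatrices m) ≡ (2 ^ m) ^ m
  length-allMatrices m = trans (length-allVecs (allSubsets m) m) (cong (_^ m) (length-allVecs _ m))

module SubsetSplitting where
  open import Data.Bool using (true; false)
  open import Data.Nat using (ℕ; _≤_; z≤n; s≤s)
  import Data.Nat.Properties as ℕP
  open import Data.Vec using (Vec; []; _∷_; lookup; tabulate)
  import Data.Vec.Properties as VecP
  open import Data.Fin using (Fin; zero; suc)
  import Data.Fin.Properties as FinP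
  open import Data.Fin.Subset using (Subset; ∣_∣; ∁; inside; outside)
  open import Data.Fin.Subset.Properties using (∣p∣≤∣x∷p∣)
  open import Data.Product using (_,_)
  open import Relation.Nullary using (does)
  open import Relation.Nullary.Decidable using (dec-true; dec-false)
  open import Function using (_∘_)
  open import Relation.Binary.PropositionalEquality

  private variable
    n : ℕ

  inside≢outside : inside ≢ outside
  inside≢outside ()

  select : (p : Subset n) → Fin ∣ p ∣ → Fin n
  select (inside  ∷ p) zero    = zero
  select (inside  ∷ p) (suc a) = suc (select p a)
  select (outside ∷ p) a       = suc (select p a)

  data Split (p : Subset n) : Fin n → Set where
    member    : (a : Fin ∣ p ∣)   → Split p (select p a)
    nonmember : (b : Fin ∣ ∁ p ∣) → Split p (select (∁ p) b)

  split : (p : Subset n) (i : Fin n) → Split p i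
  split (inside  ∷ p) zero = member zero
  split (outside ∷ p) zero = nonmember zero
  split (inside  ∷ p) (suc i) with split p i
  ... | member a    = member (suc a)
  ... | nonmember b = nonmember b
  split (outside ∷ p) (suc i) with split p i
  ... | member a    = member a
  ... | nonmember b = nonmember (suc b)

  lookup-select : (p : Subset n) (a : Fin ∣ p ∣) → lookup p (select p a) ≡ inside
  lookup-select (inside  ∷ p) zero    = refl
  lookup-select (inside  ∷ p) (suc a) = lookup-select p a
  lookup-select (outside ∷ p) a       = lookup-select p a

  lookup-select-∁ : (p : Subset n) (b : Fin ∣ ∁ p ∣) → lookup p (select (∁ p) b) ≡ outside
  lookup-select-∁ (inside  ∷ p) b       = lookup-select-∁ p b
  lookup-select-∁ (outside ∷ p) zero    = refl
  lookup-select-∁ (outside ∷ p) (suc b) = lookup-select-∁ p b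

  select≢select-∁ : (p : Subset n) (a : Fin ∣ p ∣) (b : Fin ∣ ∁ p ∣) → select p a ≢ select (∁ p) b
  select≢select-∁ p a b eq =
    inside≢outside (trans (sym (lookup-select p a)) (trans (cong (lookup p) eq) (lookup-select-∁ p b)))

  select-injective : (p : Subset n) {a b : Fin ∣ p ∣} → select p a ≡ select p b → a ≡ b
  select-injective (inside  ∷ p) {zero}  {zero}  _  = refl
  select-injective (inside  ∷ p) {suc a} {suc b} eq = cong suc (select-injective p (FinP.suc-injective eq))
  select-injective (outside ∷ p)                 eq = select-injective p (FinP.suc-injective eq)

  restrict : (S p : Subset n) → Subset ∣ p ∣
  restrict S p = tabulate (lookup S ∘ select p)

  ∣restrict∣≤∣S∣ : (S p : Subset n) → ∣ restrict S p ∣ ≤ ∣ S ∣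
  ∣restrict∣≤∣S∣ []          []            = z≤n
  ∣restrict∣≤∣S∣ (true  ∷ S) (inside  ∷ p) = s≤s (∣restrict∣≤∣S∣ S p)
  ∣restrict∣≤∣S∣ (false ∷ S) (inside  ∷ p) = ∣restrict∣≤∣S∣ S p
  ∣restrict∣≤∣S∣ (x     ∷ S) (outside ∷ p) = ℕP.≤-trans (∣restrict∣≤∣S∣ S p) (∣p∣≤∣x∷p∣ x S)

  image : ∀ {k} → Vec (Fin n) k → Subset n
  image w = tabulate λ i → does (FinP.any? λ a → lookup w a FinP.≟ i)

  image-select : (p : Subset n) → image (tabulate (select p)) ≡ p
  image-select p = trans (VecP.tabulate-cong λ i → hit i (split p i)) (VecP.tabulate∘lookup p)
    where
    hit : ∀ i → Split p i → does (FinP.any? λ a → lookup (tabulate (select p)) a FinP.≟ i) ≡ lookup p i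
    hit _ (member a)    = trans (dec-true (FinP.any? _) (a , VecP.lookup∘tabulate (select p) a))
                                (sym (lookup-select p a))
    hit _ (nonmember b) = trans (dec-false (FinP.any? _) λ (a , eq) →
                                  select≢select-∁ p a b (trans (sym (VecP.lookup∘tabulate (select p) a)) eq))
                                (sym (lookup-select-∁ p b))

module DigraphCodes where
  open import Data.Bool using (Bool; true; false)
  open import Data.Nat using (ℕ)
  open import Data.Vec using (Vec; lookup; tabulate)
  import Data.Vec.Properties as VecP
  open import Data.Fin using (Fin)
  open import Data.Fin.Subset using (Subset; ∣_∣; ∁)
  open import Data.Product using (_×_; _,_)
  open import Data.Sum using (_⊎_; inj₁; inj₂)
  open import Data.Empty using (⊥-elim)
  open import Relation.Nullary using (¬_)
  open import Function using (_∘_)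
  open import Relation.Binary.PropositionalEquality
  open SubsetSplitting

  private variable
    A : Set
    m n p : ℕ

  lookup₂ : Vec (Vec A p) m → Fin m → Fin p → A
  lookup₂ M i j = lookup (lookup M i) j

  tabulate₂ : (Fin m → Fin p → A) → Vec (Vec A p) m
  tabulate₂ f = tabulate λ i → tabulate (f i)

  lookup₂∘tabulate₂ : ∀ (f : Fin m → Fin p → A) i j → lookup₂ (tabulate₂ f) i j ≡ f i j
  lookup₂∘tabulate₂ f i j =
    trans (cong (λ row → lookup row j) (VecP.lookup∘tabulate _ i)) (VecP.lookup∘tabulate (f i) j)

  tabulate₂∘lookup₂ : ∀ {f : Fin m → Fin p → A} {M} → (∀ i j → f i j ≡ lookup₂ M i j) → tabulate₂ f ≡ M
  tabulate₂∘lookup₂ {M = M} eq =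
    trans (VecP.tabulate-cong λ i → trans (VecP.tabulate-cong (eq i)) (VecP.tabulate∘lookup (lookup M i)))
          (VecP.tabulate∘lookup M)

  submatrix : Matrix n → (Fin m → Fin n) → Matrix m
  submatrix M f = tabulate₂ λ a b → lookup₂ M (f a) (f b)

  lookup₂-submatrix : ∀ (M : Matrix n) (f : Fin m → Fin n) a b →
    lookup₂ (submatrix M f) a b ≡ lookup₂ M (f a) (f b)
  lookup₂-submatrix M f = lookup₂∘tabulate₂ λ a b → lookup₂ M (f a) (f b)

  InF-submatrix : ∀ {M : Matrix n} {f : Fin m → Fin n} → (∀ {a b} → f a ≡ f b → a ≡ b) →
    InF M → InF (submatrix M f)
  InF-submatrix {M = M} {f} f-inj ((irrefl , asym) , i3free) =
    ((λ a → irrefl (f a) ∘ to) , (λ a b e e′ → asym (f a) (f b) (to e) (to e′))) , i3free′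
    where
    to : ∀ {a b} → Arr (submatrix M f) a b → Arr M (f a) (f b)
    to = trans (sym (lookup₂-submatrix M f _ _))
    from : ∀ {a b} → Arr M (f a) (f b) ⊎ Arr M (f b) (f a) → Arr (submatrix M f) a b ⊎ Arr (submatrix M f) b a
    from (inj₁ e) = inj₁ (trans (lookup₂-submatrix M f _ _) e)
    from (inj₂ e) = inj₂ (trans (lookup₂-submatrix M f _ _) e)
    i3free′ : I3free (submatrix M f)
    i3free′ x y z x≢y x≢z y≢z with i3free (f x) (f y) (f z) (x≢y ∘ f-inj) (x≢z ∘ f-inj) (y≢z ∘ f-inj)
    ... | inj₁ exy        = inj₁ (from exy)
    ... | inj₂ (inj₁ exz) = inj₂ (inj₁ (from exz))
    ... | inj₂ (inj₂ eyz) = inj₂ (inj₂ (from eyz))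

  -- Between u ∈ Q and x ∉ Q: forward is u → x, backward is x → u.
  data Orientation : Set where
    forward backward absent : Orientation

  orient : Bool → Bool → Orientation
  orient true  _     = forward
  orient false true  = backward
  orient false false = absent

  isForward : Orientation → Bool
  isForward forward = true
  isForward _       = false

  isBackward : Orientation → Bool
  isBackward backward = true
  isBackward _        = false

  isForward-orient : ∀ u v → isForward (orient u v) ≡ u
  isForward-orient true  _     = refl
  isForward-orient false true  = refl
  isForward-orient false false = refl

  isBackward-orient : ∀ u v → ¬ (u ≡ true × v ≡ true) → isBackward (orient u v) ≡ v
  isBackward-orient true  true  ¬both = ⊥-elim (¬both (refl , refl))
  isBackward-orient true  false _     = refl
  isBackward-orient false true  _     = refl
  isBackward-orient false false _     = refl

  record Code (n : ℕ) : Set where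
    constructor code
    field
      Q        : Subset n
      outsideQ : Matrix ∣ ∁ Q ∣
      insideQ  : Matrix ∣ Q ∣
      links    : Vec (Vec Orientation ∣ ∁ Q ∣) ∣ Q ∣

  module _ (c : Code n) where
    open Code c

    decodeArrow : ∀ {i j} → Split Q i → Split Q j → Bool
    decodeArrow (member a)    (member b)    = lookup₂ insideQ a b
    decodeArrow (member a)    (nonmember y) = isForward (lookup₂ links a y)
    decodeArrow (nonmember x) (member b)    = isBackward (lookup₂ links b x)
    decodeArrow (nonmember x) (nonmember y) = lookup₂ outsideQ x y

    decode : Matrix n
    decode = tabulate₂ λ i j → decodeArrow (split Q i) (split Q j)

  linkOf : Matrix n → (Q : Subset n) → Fin ∣ Q ∣ → Fin ∣ ∁ Q ∣ → Orientation
  linkOf M Q a y = orient (lookup₂ M (select Q a) (select (∁ Q) y)) (lookup₂ M (select (∁ Q) y) (select Q a))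

  encode : Matrix n → Subset n → Code n
  encode M Q = code Q (submatrix M (select (∁ Q))) (submatrix M (select Q)) (tabulate₂ (linkOf M Q))

  decode-encode : ∀ {M : Matrix n} Q → IsDigraph M → decode (encode M Q) ≡ M
  decode-encode {M = M} Q (_ , asym) = tabulate₂∘lookup₂ λ i j → arrow (split Q i) (split Q j)
    where
    arrow : ∀ {i j} (si : Split Q i) (sj : Split Q j) → decodeArrow (encode M Q) si sj ≡ lookup₂ M i j
    arrow (member a)    (member b)    = lookup₂-submatrix M (select Q) a b
    arrow (member a)    (nonmember y) = trans (cong isForward (lookup₂∘tabulate₂ (linkOf M Q) a y))
                                              (isForward-orient _ _)
    arrow (nonmember x) (member b)    = trans (cong isBackward (lookup₂∘tabulate₂ (linkOf M Q) b x))
                                              (isBackward-orient _ _ λ (e , e′) → asym _ _ e e′)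
    arrow (nonmember x) (nonmember y) = lookup₂-submatrix M (select (∁ Q)) x y

module CodeCounting where
  open import Data.Bool using (Bool; true; false; not; _∧_)
  import Data.Bool.Properties as BoolP
  open import Data.Nat using (ℕ; zero; suc; _*_; _∸_; _^_; _≤_; z≤n; s≤s; _≤′_; ≤′-refl; ≤′-step)
  import Data.Nat.Properties as ℕP
  open import Algebra.Properties.CommutativeSemigroup ℕP.*-commutativeSemigroup using (x∙yz≈y∙xz)
  open import Data.Vec using (Vec; []; _∷_; lookup; tabulate)
  import Data.Vec as Vec
  import Data.Vec.Properties as VecP
  import Data.Fin.Properties as FinP
  open import Data.Fin.Subset using (Subset; ∣_∣; ∁)
  open import Data.Fin.Subset.Properties using (∣∁p∣≡n∸∣p∣; ∣p∣≤n)
  open import Data.List using (List; []; _∷_; map; concatMap; filter; length; allFin)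
  import Data.List.Properties as ListP
  open import Data.List.Membership.Propositional using (_∈_)
  open import Data.List.Membership.Propositional.Properties using (∈-map⁺; ∈-filter⁺; ∈-filter⁻; ∈-allFin)
  open import Data.List.Relation.Unary.Any using (here; there)
  open import Data.List.Relation.Unary.Unique.Propositional using (Unique)
  import Data.List.Relation.Unary.Unique.Propositional.Properties as UniqueP
  open import Data.List.Relation.Binary.Subset.Propositional using (_⊆_)
  open import Data.Product using (_,_; proj₁; proj₂)
  open import Data.Sum using (_⊎_; inj₁; inj₂)
  open import Relation.Nullary using (¬_; yes; no; does; contradiction)
  open import Relation.Nullary.Decidable using (dec-true; _×-dec_)
  open import Function using (_∘_)
  open import Relation.Binary.PropositionalEquality
  open Enumeration
  open SubsetSplitting
  open DigraphCodes

  private variable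
    m n : ℕ

  -- A vertex x ∉ Q with x ∉ Δ(Q) is adjacent to every vertex of Q.
  orientations : Bool → List Orientation
  orientations true  = forward ∷ backward ∷ absent ∷ []
  orientations false = forward ∷ backward ∷ []

  orient∈orientations : ∀ {u v} b → (b ≡ false → u ≡ true ⊎ v ≡ true) → orient u v ∈ orientations b
  orient∈orientations {true}  {_}     true  _        = here refl
  orient∈orientations {true}  {_}     false _        = here refl
  orient∈orientations {false} {true}  true  _        = there (here refl)
  orient∈orientations {false} {false} true  _        = there (there (here refl))
  orient∈orientations {false} {true}  false _        = there (here refl)
  orient∈orientations {false} {false} false adjacent with adjacent refl
  ... | inj₁ ()
  ... | inj₂ ()

  linkRows : Subset m → List (Vec Orientation m)
  linkRows S = allChoices (Vec.map orientations S)

  length-linkRows : (S : Subset m) → length (linkRows S) ≡ 3 ^ ∣ S ∣ * 2 ^ ∣ ∁ S ∣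
  length-linkRows []          = refl
  length-linkRows (true ∷ S)  = begin
    length (linkRows (true ∷ S))   ≡⟨ length-cartesianProductWith _∷_ (orientations true) (linkRows S) ⟩
    3 * length (linkRows S)        ≡⟨ cong (3 *_) (length-linkRows S) ⟩
    3 * (3 ^ ∣ S ∣ * 2 ^ ∣ ∁ S ∣)  ≡⟨ ℕP.*-assoc 3 (3 ^ ∣ S ∣) (2 ^ ∣ ∁ S ∣) ⟨
    3 ^ suc ∣ S ∣ * 2 ^ ∣ ∁ S ∣    ∎
    where open ≡-Reasoning
  length-linkRows (false ∷ S) = begin
    length (linkRows (false ∷ S))  ≡⟨ length-cartesianProductWith _∷_ (orientations false) (linkRows S) ⟩
    2 * length (linkRows S)        ≡⟨ cong (2 *_) (length-linkRows S) ⟩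
    2 * (3 ^ ∣ S ∣ * 2 ^ ∣ ∁ S ∣)  ≡⟨ x∙yz≈y∙xz 2 (3 ^ ∣ S ∣) (2 ^ ∣ ∁ S ∣) ⟩
    3 ^ ∣ S ∣ * 2 ^ suc ∣ ∁ S ∣    ∎
    where open ≡-Reasoning

  2^∸≤3*2^∸suc : ∀ m j → 2 ^ (m ∸ j) ≤ 3 * 2 ^ (m ∸ suc j)
  2^∸≤3*2^∸suc zero    zero    = s≤s z≤n
  2^∸≤3*2^∸suc zero    (suc j) = s≤s z≤n
  2^∸≤3*2^∸suc (suc m) zero    = ℕP.*-monoˡ-≤ (2 ^ m) (ℕP.n≤1+n 2)
  2^∸≤3*2^∸suc (suc m) (suc j) = 2^∸≤3*2^∸suc m j

  3^*2^∸-mono : ∀ m {j s} → j ≤ s → 3 ^ j * 2 ^ (m ∸ j) ≤ 3 ^ s * 2 ^ (m ∸ s)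
  3^*2^∸-mono m j≤s = mono (ℕP.≤⇒≤′ j≤s)
    where
    mono : ∀ {j s} → j ≤′ s → 3 ^ j * 2 ^ (m ∸ j) ≤ 3 ^ s * 2 ^ (m ∸ s)
    mono ≤′-refl                = ℕP.≤-refl
    mono {j} (≤′-step {s} j≤′s) = begin
      3 ^ j * 2 ^ (m ∸ j)            ≤⟨ mono j≤′s ⟩
      3 ^ s * 2 ^ (m ∸ s)            ≤⟨ ℕP.*-monoʳ-≤ (3 ^ s) (2^∸≤3*2^∸suc m s) ⟩
      3 ^ s * (3 * 2 ^ (m ∸ suc s))  ≡⟨ ℕP.*-assoc (3 ^ s) 3 _ ⟨
      3 ^ s * 3 * 2 ^ (m ∸ suc s)    ≡⟨ cong (_* 2 ^ (m ∸ suc s)) (ℕP.*-comm (3 ^ s) 3) ⟩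
      3 ^ suc s * 2 ^ (m ∸ suc s)    ∎
      where open ℕP.≤-Reasoning

  length-linkRows-≤ : ∀ {s} (S : Subset m) → ∣ S ∣ ≤ s → length (linkRows S) ≤ 3 ^ s * 2 ^ (m ∸ s)
  length-linkRows-≤ {m} {s} S ∣S∣≤s = begin
    length (linkRows S)          ≡⟨ length-linkRows S ⟩
    3 ^ ∣ S ∣ * 2 ^ ∣ ∁ S ∣      ≡⟨ cong (λ r → 3 ^ ∣ S ∣ * 2 ^ r) (∣∁p∣≡n∸∣p∣ S) ⟩
    3 ^ ∣ S ∣ * 2 ^ (m ∸ ∣ S ∣)  ≤⟨ 3^*2^∸-mono m ∣S∣≤s ⟩
    3 ^ s * 2 ^ (m ∸ s)          ∎
    where open ℕP.≤-Reasoning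

  kSubsets : (n k : ℕ) → List (Subset n)
  kSubsets n k = filter (λ Q → ∣ Q ∣ ℕP.≟ k) (map image (allVecs (allFin n) k))

  sparseSubsets : ℕ → (m : ℕ) → List (Subset m)
  sparseSubsets s m = filter (λ S → ∣ S ∣ ℕP.≤? s) (allSubsets m)

  codesOn : ℕ → (Q : Subset n) → List (Code n)
  codesOn {n} s Q = concatMap withOutside (filter InF? (allMatrices ∣ ∁ Q ∣))
    module codesOn where
    withLinks : Matrix ∣ ∁ Q ∣ → Matrix ∣ Q ∣ → Subset ∣ ∁ Q ∣ → List (Code n)
    withLinks G A S = map (code Q G A) (allVecs (linkRows S) ∣ Q ∣)
    withInside : Matrix ∣ ∁ Q ∣ → Matrix ∣ Q ∣ → List (Code n)
    withInside G A = concatMap (withLinks G A) (sparseSubsets s ∣ ∁ Q ∣)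
    withOutside : Matrix ∣ ∁ Q ∣ → List (Code n)
    withOutside G = concatMap (withInside G) (allMatrices ∣ Q ∣)

  codes : (n k s : ℕ) → List (Code n)
  codes n k s = concatMap (codesOn s) (kSubsets n k)

  -- inside digraphs × sets S × link tables, for |Q| = q, |∁ Q| = r and |S| ≤ s
  #codesPerOutside : (q r s : ℕ) → ℕ
  #codesPerOutside q r s = (2 ^ q) ^ q * (2 ^ r * (3 ^ s * 2 ^ (r ∸ s)) ^ q)

  codeCount : (n k s : ℕ) → ℕ
  codeCount n k s = n ^ k * #codesPerOutside k (n ∸ k) s

  length-kSubsets : ∀ n k → length (kSubsets n k) ≤ n ^ k
  length-kSubsets n k = begin
    length (kSubsets n k)                     ≤⟨ ListP.length-filter _ (map image (allVecs (allFin n) k)) ⟩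
    length (map image (allVecs (allFin n) k)) ≡⟨ ListP.length-map image (allVecs (allFin n) k) ⟩
    length (allVecs (allFin n) k)             ≡⟨ length-allVecs (allFin n) k ⟩
    length (allFin n) ^ k                     ≡⟨ cong (_^ k) (ListP.length-tabulate (λ i → i)) ⟩
    n ^ k                                     ∎
    where open ℕP.≤-Reasoning

  length-codesOn : ∀ s (Q : Subset n) → length (codesOn s Q) ≤ #F ∣ ∁ Q ∣ * #codesPerOutside ∣ Q ∣ ∣ ∁ Q ∣ s
  length-codesOn s Q = length-concatMap-≤ withOutside _ (filter InF? (allMatrices r)) λ _ → length-withOutside
    where
    open codesOn s Q
    q = ∣ Q ∣
    r = ∣ ∁ Q ∣
    length-withLinks : ∀ {G A S} → S ∈ sparseSubsets s r → length (withLinks G A S) ≤ (3 ^ s * 2 ^ (r ∸ s)) ^ q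
    length-withLinks {G} {A} {S} S∈ = begin
      length (withLinks G A S)          ≡⟨ ListP.length-map (code Q G A) (allVecs (linkRows S) q) ⟩
      length (allVecs (linkRows S) q)   ≡⟨ length-allVecs (linkRows S) q ⟩
      length (linkRows S) ^ q           ≤⟨ ℕP.^-monoˡ-≤ q (length-linkRows-≤ S ∣S∣≤s) ⟩
      (3 ^ s * 2 ^ (r ∸ s)) ^ q         ∎
      where
      open ℕP.≤-Reasoning
      ∣S∣≤s = proj₂ (∈-filter⁻ (λ S → ∣ S ∣ ℕP.≤? s) {S} {allSubsets r} S∈)
    length-withInside : ∀ {G A} → length (withInside G A) ≤ 2 ^ r * (3 ^ s * 2 ^ (r ∸ s)) ^ q
    length-withInside {G} {A} = ℕP.≤-trans
      (length-concatMap-≤ (withLinks G A) _ (sparseSubsets s r) length-withLinks)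
      (ℕP.*-monoˡ-≤ _ (ℕP.≤-trans (ListP.length-filter _ (allSubsets r)) (ℕP.≤-reflexive (length-allVecs _ r))))
    length-withOutside : ∀ {G} → length (withOutside G) ≤ #codesPerOutside q r s
    length-withOutside {G} = subst (λ c → length (withOutside G) ≤ c * (2 ^ r * (3 ^ s * 2 ^ (r ∸ s)) ^ q))
      (length-allMatrices q) (length-concatMap-≤ (withInside G) _ (allMatrices q) λ _ → length-withInside)

  length-codes : ∀ n k s → length (codes n k s) ≤ n ^ k * (#F (n ∸ k) * #codesPerOutside k (n ∸ k) s)
  length-codes n k s = ℕP.≤-trans (length-concatMap-≤ (codesOn s) _ (kSubsets n k) bound)
                                  (ℕP.*-monoˡ-≤ _ (length-kSubsets n k))
    where
    bound : ∀ {Q} → Q ∈ kSubsets n k → length (codesOn s Q) ≤ #F (n ∸ k) * #codesPerOutside k (n ∸ k) s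
    bound {Q} Q∈ with proj₂ (∈-filter⁻ (λ P → ∣ P ∣ ℕP.≟ k) {Q} {map image (allVecs (allFin n) k)} Q∈)
    ... | refl = subst (λ r → length (codesOn s Q) ≤ #F r * #codesPerOutside ∣ Q ∣ r s) (∣∁p∣≡n∸∣p∣ Q)
                       (length-codesOn s Q)

  nonAdjacent⇒∈ΔS : ∀ (M : Matrix n) Q a y →
    ¬ Arr M (select Q a) (select (∁ Q) y) → ¬ Arr M (select (∁ Q) y) (select Q a) →
    lookup (ΔS M Q) (select (∁ Q) y) ≡ true
  nonAdjacent⇒∈ΔS M Q a y u↛x x↛u = begin
    lookup (ΔS M Q) x                                ≡⟨ VecP.lookup∘tabulate _ x ⟩
    not (lookup Q x) ∧ does (FinP.any? adjacentInQ)  ≡⟨ cong (λ b → not b ∧ does (FinP.any? adjacentInQ))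
                                                             (lookup-select-∁ Q y) ⟩
    does (FinP.any? adjacentInQ)                     ≡⟨ dec-true (FinP.any? adjacentInQ)
                                                          (select Q a , lookup-select Q a ,
                                                           select≢select-∁ Q a y ∘ sym , x↛u , u↛x) ⟩
    true                                             ∎
    where
    open ≡-Reasoning
    x = select (∁ Q) y
    adjacentInQ = λ v → (lookup Q v BoolP.≟ true) ×-dec NonAdj? M x v

  ∉ΔS⇒adjacent : ∀ (M : Matrix n) Q a y → lookup (ΔS M Q) (select (∁ Q) y) ≡ false →
    Arr M (select Q a) (select (∁ Q) y) ⊎ Arr M (select (∁ Q) y) (select Q a)
  ∉ΔS⇒adjacent M Q a y x∉ΔQ with Arr? M (select Q a) (select (∁ Q) y) | Arr? M (select (∁ Q) y) (select Q a)
  ... | yes u→x | _       = inj₁ u→x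
  ... | no _    | yes x→u = inj₂ x→u
  ... | no u↛x  | no x↛u  = contradiction (trans (sym (nonAdjacent⇒∈ΔS M Q a y u↛x x↛u)) x∉ΔQ) λ ()

  encode∈codes : ∀ {M : Matrix n} {s} Q → InF M → ∣ restrict (ΔS M Q) (∁ Q) ∣ ≤ s →
    encode M Q ∈ codes n ∣ Q ∣ s
  encode∈codes {n} {M} {s} Q inF ∣S∣≤s =
    ∈-concatMap (codesOn s) Q∈ (∈-concatMap withOutside G∈ (∈-concatMap (withInside G) (∈-allMatrices A)
      (∈-concatMap (withLinks G A) S∈ (∈-map⁺ (code Q G A) links∈))))
    where
    open codesOn s Q
    G = submatrix M (select (∁ Q))
    A = submatrix M (select Q)
    S = restrict (ΔS M Q) (∁ Q)
    Q∈ : Q ∈ kSubsets n ∣ Q ∣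
    Q∈ = ∈-filter⁺ (λ P → ∣ P ∣ ℕP.≟ ∣ Q ∣)
      (subst (_∈ map image (allVecs (allFin n) ∣ Q ∣)) (image-select Q)
             (∈-map⁺ image (∈-allVecs {v = tabulate (select Q)} λ _ → ∈-allFin _))) refl
    G∈ : G ∈ filter InF? (allMatrices ∣ ∁ Q ∣)
    G∈ = ∈-filter⁺ InF? (∈-allMatrices G) (InF-submatrix {M = M} (select-injective (∁ Q)) inF)
    S∈ : S ∈ sparseSubsets s ∣ ∁ Q ∣
    S∈ = ∈-filter⁺ (λ S → ∣ S ∣ ℕP.≤? s) (∈-allSubsets S) ∣S∣≤s
    link∈ : ∀ a y → linkOf M Q a y ∈ lookup (Vec.map orientations S) y
    link∈ a y = subst (linkOf M Q a y ∈_) (sym (VecP.lookup-map y orientations S))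
      (orient∈orientations (lookup S y) λ y∉S → ∉ΔS⇒adjacent M Q a y (trans (sym (VecP.lookup∘tabulate _ y)) y∉S))
    links∈ : tabulate₂ (linkOf M Q) ∈ allVecs (linkRows S) ∣ Q ∣
    links∈ = ∈-allVecs λ a → subst (_∈ linkRows S) (sym (VecP.lookup∘tabulate _ a))
      (∈-allChoices {Ls = Vec.map orientations S} λ y →
        subst (_∈ lookup (Vec.map orientations S) y) (sym (VecP.lookup∘tabulate _ y)) (link∈ a y))

  SparseBound : (n k s : ℕ) → Set
  SparseBound n k s = ∀ {j} → j ≤ n ∸ k → 1000000 * j ≤ 499999 * n → j ≤ s

  -- Arguments next to the literal 1000000 are passed explicitly: inferring them makes Agda
  -- unfold 1000000 * j into a million additions.
  InB⇒∈decode-codes : ∀ {n k s} → SparseBound n k s → {M : Matrix n} → InB k M →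
    M ∈ map decode (codes n k s)
  InB⇒∈decode-codes {n} {s = s} sparse {M} ((inF , _) , _ , Q , (_ , refl) , ΔQ-sparse) =
    subst (_∈ map decode (codes n ∣ Q ∣ s)) (decode-encode Q (proj₁ inF))
      (∈-map⁺ decode (encode∈codes {M = M} Q inF (sparse {∣ restrict (ΔS M Q) (∁ Q) ∣} S≤n-k S-sparse)))
    where
    S≤n-k : ∣ restrict (ΔS M Q) (∁ Q) ∣ ≤ n ∸ ∣ Q ∣
    S≤n-k = subst (∣ restrict (ΔS M Q) (∁ Q) ∣ ≤_) (∣∁p∣≡n∸∣p∣ Q) (∣p∣≤n (restrict (ΔS M Q) (∁ Q)))
    S-sparse : 1000000 * ∣ restrict (ΔS M Q) (∁ Q) ∣ ≤ 499999 * n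
    S-sparse = ℕP.≤-trans (ℕP.*-monoʳ-≤ 1000000 (∣restrict∣≤∣S∣ (ΔS M Q) (∁ Q))) ΔQ-sparse

  #B≤#F*codeCount : ∀ n k s → SparseBound n k s → #B n k ≤ #F (n ∸ k) * codeCount n k s
  #B≤#F*codeCount n k s sparse = begin
    #B n k                                               ≤⟨ Unique-⊆⇒length-≤ B-unique B⊆decoded ⟩
    length (map decode (codes n k s))                    ≡⟨ ListP.length-map decode (codes n k s) ⟩
    length (codes n k s)                                 ≤⟨ length-codes n k s ⟩
    n ^ k * (#F (n ∸ k) * #codesPerOutside k (n ∸ k) s)  ≡⟨ x∙yz≈y∙xz (n ^ k) (#F (n ∸ k)) _ ⟩
    #F (n ∸ k) * codeCount n k s                         ∎
    where
    open ℕP.≤-Reasoning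
    B-unique : Unique (filter (InB? k) (allMatrices n))
    B-unique = UniqueP.filter⁺ (InB? k) (allMatrices-unique n)
    B⊆decoded : filter (InB? k) (allMatrices n) ⊆ map decode (codes n k s)
    B⊆decoded {M} M∈ =
      InB⇒∈decode-codes {n} {k} {s} sparse {M} (proj₂ (∈-filter⁻ (InB? k) {M} {allMatrices n} M∈))

module NatToRational where
  open import Data.Nat using (ℕ; suc)
  import Data.Nat as ℕ
  import Data.Nat.Properties as ℕP
  open import Data.Nat.Coprimality as Coprime using (Coprime)
  open import Data.Integer using (+_; +≤+)
  import Data.Integer as ℤ
  import Data.Integer.Properties as ℤP
  open import Data.Rational using (ℚ; mkℚ; *≤*; Positive; NonNegative; _/_; _+_; _*_; _-_; _≤_)
  import Data.Rational.Properties as ℚP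
  import Data.Rational.Unnormalised as ℚᵘ
  import Data.Rational.Unnormalised.Properties as ℚᵘP
  open import Data.Rational.Solver using (module +-*-Solver)
  open import Relation.Binary.PropositionalEquality

  private
    [_]/1 : ℕ → ℚ
    [ a ]/1 = mkℚ (+ a) 0 (Coprime.sym (Coprime.1-coprimeTo a))

    ℕ→ℚ≡[_]/1 : ∀ a → ℕ→ℚ a ≡ [ a ]/1
    ℕ→ℚ≡[ a ]/1 = ℚP.normalize-coprime (Coprime.sym (Coprime.1-coprimeTo a))

  ℕ→ℚ-+ : ∀ a b → ℕ→ℚ (a ℕ.+ b) ≡ ℕ→ℚ a + ℕ→ℚ b
  ℕ→ℚ-+ a b = sym (trans (cong₂ _+_ ℕ→ℚ≡[ a ]/1 ℕ→ℚ≡[ b ]/1)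
    (cong (_/ 1) (trans (cong₂ ℤ._+_ (ℤP.*-identityʳ (+ a)) (ℤP.*-identityʳ (+ b))) (sym (ℤP.pos-+ a b)))))

  ℕ→ℚ-* : ∀ a b → ℕ→ℚ (a ℕ.* b) ≡ ℕ→ℚ a * ℕ→ℚ b
  ℕ→ℚ-* a b = sym (trans (cong₂ _*_ ℕ→ℚ≡[ a ]/1 ℕ→ℚ≡[ b ]/1) (cong (_/ 1) (sym (ℤP.pos-* a b))))

  ℕ→ℚ-∸ : ∀ {a b} → b ℕ.≤ a → ℕ→ℚ (a ℕ.∸ b) ≡ ℕ→ℚ a - ℕ→ℚ b
  ℕ→ℚ-∸ {a} {b} b≤a = begin
    ℕ→ℚ (a ℕ.∸ b)                  ≡⟨ solve 2 (λ x y → x := x :+ y :- y) refl (ℕ→ℚ (a ℕ.∸ b)) (ℕ→ℚ b) ⟩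
    ℕ→ℚ (a ℕ.∸ b) + ℕ→ℚ b - ℕ→ℚ b  ≡⟨ cong (_- ℕ→ℚ b) (ℕ→ℚ-+ (a ℕ.∸ b) b) ⟨
    ℕ→ℚ (a ℕ.∸ b ℕ.+ b) - ℕ→ℚ b    ≡⟨ cong (λ x → ℕ→ℚ x - ℕ→ℚ b) (ℕP.m∸n+n≡m b≤a) ⟩
    ℕ→ℚ a - ℕ→ℚ b                  ∎
    where
    open ≡-Reasoning
    open +-*-Solver

  ℕ→ℚ-mono-≤ : ∀ {a b} → a ℕ.≤ b → ℕ→ℚ a ≤ ℕ→ℚ b
  ℕ→ℚ-mono-≤ {a} {b} a≤b = subst₂ _≤_ (sym ℕ→ℚ≡[ a ]/1) (sym ℕ→ℚ≡[ b ]/1)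
    (*≤* (subst₂ ℤ._≤_ (sym (ℤP.*-identityʳ (+ a))) (sym (ℤP.*-identityʳ (+ b))) (+≤+ a≤b)))

  ℕ→ℚ-nonNeg : ∀ a → NonNegative (ℕ→ℚ a)
  ℕ→ℚ-nonNeg a rewrite ℕ→ℚ≡[ a ]/1 = _

  ℕ→ℚ-pos : ∀ {a} → 0 ℕ.< a → Positive (ℕ→ℚ a)
  ℕ→ℚ-pos {suc a} _ rewrite ℕ→ℚ≡[ suc a ]/1 = _

  *-monoʳ-ℕ→ℚ : ∀ {x y} d → x ≤ y → x * ℕ→ℚ d ≤ y * ℕ→ℚ d
  *-monoʳ-ℕ→ℚ d = ℚP.*-monoʳ-≤-nonNeg (ℕ→ℚ d) {{ℕ→ℚ-nonNeg d}}

  mkℚ*den≡num : ∀ p d .(c : Coprime p (suc d)) → mkℚ (+ p) d c * ℕ→ℚ (suc d) ≡ ℕ→ℚ p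
  mkℚ*den≡num p d c = begin
    mkℚ (+ p) d c * ℕ→ℚ (suc d)    ≡⟨ cong (mkℚ (+ p) d c *_) ℕ→ℚ≡[ suc d ]/1 ⟩
    mkℚ (+ p) d c * [ suc d ]/1    ≡⟨ ℚP.toℚᵘ-injective (ℚᵘP.≃-trans (ℚP.toℚᵘ-homo-* (mkℚ (+ p) d c) [ suc d ]/1)
                                                                    (ℚᵘ.*≡* cross)) ⟩
    [ p ]/1                        ≡⟨ ℕ→ℚ≡[ p ]/1 ⟨
    ℕ→ℚ p                          ∎
    where
    open ≡-Reasoning
    cross : (+ p ℤ.* + suc d) ℤ.* + 1 ≡ + p ℤ.* + suc (d ℕ.* 1)
    cross = trans (ℤP.*-identityʳ _) (cong (λ z → + p ℤ.* + suc z) (sym (ℕP.*-identityʳ d)))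

module Log₂Bounds where
  open import Data.Nat using (ℕ; zero; suc; _^_; z≤n; s≤s)
  import Data.Nat as ℕ
  import Data.Nat.Properties as ℕP
  open import Algebra.Properties.CommutativeSemigroup ℕP.*-commutativeSemigroup using (interchange)
  open import Data.Integer using (+_; -[1+_])
  open import Data.Rational using (ℚ; mkℚ; 0ℚ; _+_; _*_; _≤_)
  import Data.Rational.Properties as ℚP
  open import Data.Rational.Solver using (module +-*-Solver)
  open import Data.Empty using (⊥-elim)
  open import Relation.Binary.PropositionalEquality
  open NatToRational

  ^-distribʳ-* : ∀ a b n → (a ℕ.* b) ^ n ≡ a ^ n ℕ.* b ^ n
  ^-distribʳ-* a b zero    = refl
  ^-distribʳ-* a b (suc n) = trans (cong (a ℕ.* b ℕ.*_) (^-distribʳ-* a b n)) (interchange a b (a ^ n) (b ^ n))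

  2^-cancel-≤ : ∀ {a b} → 2 ^ a ℕ.≤ 2 ^ b → a ℕ.≤ b
  2^-cancel-≤ 2^a≤2^b = ℕP.≮⇒≥ λ b<a → ℕP.<⇒≱ (ℕP.^-monoʳ-< 2 (s≤s (s≤s z≤n)) b<a) 2^a≤2^b

  pow≤-scale : ∀ {c D E} j → c ^ D ℕ.≤ 2 ^ E → c ^ (D ℕ.* j) ℕ.≤ 2 ^ (E ℕ.* j)
  pow≤-scale {c} {D} {E} j c^D≤2^E = begin
    c ^ (D ℕ.* j)  ≡⟨ ℕP.^-*-assoc c D j ⟨
    (c ^ D) ^ j    ≤⟨ ℕP.^-monoˡ-≤ j c^D≤2^E ⟩
    (2 ^ E) ^ j    ≡⟨ ℕP.^-*-assoc 2 E j ⟩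
    2 ^ (E ℕ.* j)  ∎
    where open ℕP.≤-Reasoning

  cross-exponents-≤ : ∀ {c p d D E} → 2 ^ p ℕ.≤ c ^ d → c ^ D ℕ.≤ 2 ^ E → p ℕ.* D ℕ.≤ E ℕ.* d
  cross-exponents-≤ {c} {p} {d} {D} {E} 2^p≤c^d c^D≤2^E = 2^-cancel-≤ (begin
    2 ^ (p ℕ.* D)  ≡⟨ ℕP.^-*-assoc 2 p D ⟨
    (2 ^ p) ^ D    ≤⟨ ℕP.^-monoˡ-≤ D 2^p≤c^d ⟩
    (c ^ d) ^ D    ≡⟨ trans (ℕP.^-*-assoc c d D) (cong (c ^_) (ℕP.*-comm d D)) ⟩
    c ^ (D ℕ.* d)  ≤⟨ pow≤-scale {c} {D} {E} d c^D≤2^E ⟩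
    2 ^ (E ℕ.* d)  ∎)
    where open ℕP.≤-Reasoning

  -- c ^ den ≤ 2 ^ exp says log₂ c ≤ exp / den, so this is exactly log₂ c ≤ r for rational r.
  record Log₂≤ (c : ℕ) (r : ℚ) : Set where
    field
      den exp : ℕ
      den>0   : 0 ℕ.< den
      pow≤    : c ^ den ℕ.≤ 2 ^ exp
      exp≤    : ℕ→ℚ exp ≤ r * ℕ→ℚ den

  Log₂≤-mono : ∀ {c r r′} → r ≤ r′ → Log₂≤ c r → Log₂≤ c r′
  Log₂≤-mono r≤r′ b = record
    { den = den ; exp = exp ; den>0 = den>0 ; pow≤ = pow≤
    ; exp≤ = ℚP.≤-trans exp≤ (*-monoʳ-ℕ→ℚ den r≤r′) }
    where open Log₂≤ b

  Log₂≤-2^ : ∀ j → Log₂≤ (2 ^ j) (ℕ→ℚ j)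
  Log₂≤-2^ j = record
    { den = 1 ; exp = j ; den>0 = s≤s z≤n
    ; pow≤ = ℕP.≤-reflexive (ℕP.^-identityʳ (2 ^ j))
    ; exp≤ = ℚP.≤-reflexive (sym (ℚP.*-identityʳ (ℕ→ℚ j))) }

  Log₂≤-^ : ∀ {c r} j → Log₂≤ c r → Log₂≤ (c ^ j) (ℕ→ℚ j * r)
  Log₂≤-^ {c} {r} j b = record
    { den = D ; exp = E ℕ.* j ; den>0 = den>0
    ; pow≤ = subst (ℕ._≤ 2 ^ (E ℕ.* j)) (trans (cong (c ^_) (ℕP.*-comm D j)) (sym (ℕP.^-*-assoc c j D)))
                   (pow≤-scale {c} {D} {E} j pow≤)
    ; exp≤ = begin
        ℕ→ℚ (E ℕ.* j)      ≡⟨ ℕ→ℚ-* E j ⟩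
        ℕ→ℚ E * ℕ→ℚ j      ≤⟨ *-monoʳ-ℕ→ℚ j exp≤ ⟩
        r * ℕ→ℚ D * ℕ→ℚ j  ≡⟨ solve 3 (λ r D j → r :* D :* j := j :* r :* D) refl r (ℕ→ℚ D) (ℕ→ℚ j) ⟩
        ℕ→ℚ j * r * ℕ→ℚ D  ∎ }
    where
    open Log₂≤ b renaming (den to D; exp to E)
    open ℚP.≤-Reasoning
    open +-*-Solver

  Log₂≤-* : ∀ {c₁ c₂ r₁ r₂} → Log₂≤ c₁ r₁ → Log₂≤ c₂ r₂ → Log₂≤ (c₁ ℕ.* c₂) (r₁ + r₂)
  Log₂≤-* {c₁} {c₂} {r₁} {r₂} b₁ b₂ = record
    { den = D₁ ℕ.* D₂ ; exp = E₁ ℕ.* D₂ ℕ.+ E₂ ℕ.* D₁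
    ; den>0 = ℕP.*-mono-≤ (Log₂≤.den>0 b₁) (Log₂≤.den>0 b₂)
    ; pow≤ = pow≤ ; exp≤ = exp≤ }
    where
    open Log₂≤ b₁ using () renaming (den to D₁; exp to E₁)
    open Log₂≤ b₂ using () renaming (den to D₂; exp to E₂)
    pow≤ : (c₁ ℕ.* c₂) ^ (D₁ ℕ.* D₂) ℕ.≤ 2 ^ (E₁ ℕ.* D₂ ℕ.+ E₂ ℕ.* D₁)
    pow≤ = begin
      (c₁ ℕ.* c₂) ^ (D₁ ℕ.* D₂)              ≡⟨ ^-distribʳ-* c₁ c₂ (D₁ ℕ.* D₂) ⟩
      c₁ ^ (D₁ ℕ.* D₂) ℕ.* c₂ ^ (D₁ ℕ.* D₂)  ≡⟨ cong (λ e → c₁ ^ (D₁ ℕ.* D₂) ℕ.* c₂ ^ e) (ℕP.*-comm D₁ D₂) ⟩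
      c₁ ^ (D₁ ℕ.* D₂) ℕ.* c₂ ^ (D₂ ℕ.* D₁)  ≤⟨ ℕP.*-mono-≤ (pow≤-scale {c₁} {D₁} {E₁} D₂ (Log₂≤.pow≤ b₁))
                                                            (pow≤-scale {c₂} {D₂} {E₂} D₁ (Log₂≤.pow≤ b₂)) ⟩
      2 ^ (E₁ ℕ.* D₂) ℕ.* 2 ^ (E₂ ℕ.* D₁)    ≡⟨ ℕP.^-distribˡ-+-* 2 (E₁ ℕ.* D₂) (E₂ ℕ.* D₁) ⟨
      2 ^ (E₁ ℕ.* D₂ ℕ.+ E₂ ℕ.* D₁)          ∎
      where open ℕP.≤-Reasoning
    exp≤ : ℕ→ℚ (E₁ ℕ.* D₂ ℕ.+ E₂ ℕ.* D₁) ≤ (r₁ + r₂) * ℕ→ℚ (D₁ ℕ.* D₂)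
    exp≤ = begin
      ℕ→ℚ (E₁ ℕ.* D₂ ℕ.+ E₂ ℕ.* D₁)
        ≡⟨ trans (ℕ→ℚ-+ (E₁ ℕ.* D₂) (E₂ ℕ.* D₁)) (cong₂ _+_ (ℕ→ℚ-* E₁ D₂) (ℕ→ℚ-* E₂ D₁)) ⟩
      ℕ→ℚ E₁ * ℕ→ℚ D₂ + ℕ→ℚ E₂ * ℕ→ℚ D₁
        ≤⟨ ℚP.+-mono-≤ (*-monoʳ-ℕ→ℚ D₂ (Log₂≤.exp≤ b₁)) (*-monoʳ-ℕ→ℚ D₁ (Log₂≤.exp≤ b₂)) ⟩
      r₁ * ℕ→ℚ D₁ * ℕ→ℚ D₂ + r₂ * ℕ→ℚ D₂ * ℕ→ℚ D₁
        ≡⟨ solve 4 (λ r₁ r₂ D₁ D₂ → r₁ :* D₁ :* D₂ :+ r₂ :* D₂ :* D₁ := (r₁ :+ r₂) :* (D₁ :* D₂))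
                 refl r₁ r₂ (ℕ→ℚ D₁) (ℕ→ℚ D₂) ⟩
      (r₁ + r₂) * (ℕ→ℚ D₁ * ℕ→ℚ D₂)
        ≡⟨ cong ((r₁ + r₂) *_) (ℕ→ℚ-* D₁ D₂) ⟨
      (r₁ + r₂) * ℕ→ℚ (D₁ ℕ.* D₂)
        ∎
      where
      open ℚP.≤-Reasoning
      open +-*-Solver

  <Pow2⇒Log₂≤ : ∀ {c r} → 0 ℕ.< c → <Pow2 c r → Log₂≤ c r
  <Pow2⇒Log₂≤ {c} {mkℚ (+ p) d cop} _ c^d<2^p = record
    { den = suc d ; exp = p ; den>0 = s≤s z≤n ; pow≤ = ℕP.<⇒≤ c^d<2^p
    ; exp≤ = ℚP.≤-reflexive (sym (mkℚ*den≡num p d cop)) }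
  <Pow2⇒Log₂≤ {c} {mkℚ -[1+ p ] d cop} 0<c c^d*2^p<1 =
    ⊥-elim (ℕP.<⇒≱ c^d*2^p<1 (ℕP.*-mono-≤ (ℕP.m^n>0 c {{ℕ.>-nonZero 0<c}} (suc d)) (ℕP.m^n>0 2 (suc p))))

  lower≤upper : ∀ {c r} p d q → 0 ℕ.< d → q * ℕ→ℚ d ≡ ℕ→ℚ p → 2 ^ p ℕ.≤ c ^ d → Log₂≤ c r → q ≤ r
  lower≤upper {c} {r} p d q d>0 q*d≡p 2^p≤c^d b =
    ℚP.*-cancelʳ-≤-pos (ℕ→ℚ (d ℕ.* D)) {{ℕ→ℚ-pos (ℕP.*-mono-≤ d>0 den>0)}} (begin
      q * ℕ→ℚ (d ℕ.* D)    ≡⟨ trans (cong (q *_) (ℕ→ℚ-* d D)) (sym (ℚP.*-assoc q _ _)) ⟩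
      q * ℕ→ℚ d * ℕ→ℚ D    ≡⟨ trans (cong (_* ℕ→ℚ D) q*d≡p) (sym (ℕ→ℚ-* p D)) ⟩
      ℕ→ℚ (p ℕ.* D)        ≤⟨ ℕ→ℚ-mono-≤ (cross-exponents-≤ {c} {p} {d} {D} {E} 2^p≤c^d pow≤) ⟩
      ℕ→ℚ (E ℕ.* d)        ≡⟨ ℕ→ℚ-* E d ⟩
      ℕ→ℚ E * ℕ→ℚ d        ≤⟨ *-monoʳ-ℕ→ℚ d exp≤ ⟩
      r * ℕ→ℚ D * ℕ→ℚ d    ≡⟨ solve 3 (λ r D d → r :* D :* d := r :* (d :* D)) refl r (ℕ→ℚ D) (ℕ→ℚ d) ⟩
      r * (ℕ→ℚ d * ℕ→ℚ D)  ≡⟨ cong (r *_) (ℕ→ℚ-* d D) ⟨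
      r * ℕ→ℚ (d ℕ.* D)    ∎)
    where
    open Log₂≤ b renaming (den to D; exp to E)
    open ℚP.≤-Reasoning
    open +-*-Solver

  2^k≤c⇒k≤r : ∀ {c r} k → 2 ^ k ℕ.≤ c → Log₂≤ c r → ℕ→ℚ k ≤ r
  2^k≤c⇒k≤r {c} k 2^k≤c = lower≤upper k 1 (ℕ→ℚ k) (s≤s z≤n) (ℚP.*-identityʳ (ℕ→ℚ k))
    (subst (2 ^ k ℕ.≤_) (sym (ℕP.^-identityʳ c)) 2^k≤c)

  Log₂≤⇒0≤ : ∀ {c r} → Log₂≤ c r → 0ℚ ≤ r
  Log₂≤⇒0≤ b = ℚP.*-cancelʳ-≤-pos (ℕ→ℚ den) {{ℕ→ℚ-pos den>0}}
    (ℚP.≤-trans (ℚP.≤-reflexive (ℚP.*-zeroˡ (ℕ→ℚ den)))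
                (ℚP.≤-trans (ℚP.nonNegative⁻¹ _ {{ℕ→ℚ-nonNeg exp}}) exp≤))
    where open Log₂≤ b

  Pow2<⇒≤ : ∀ {q x y c r} → Pow2< q x y → x ℕ.≤ y ℕ.* c → Log₂≤ c r → q ≤ r
  Pow2<⇒≤ {mkℚ (+ p) d cop} {x} {y} {c} 2^p*y^d<x^d x≤y*c =
    lower≤upper p (suc d) _ (s≤s z≤n) (mkℚ*den≡num p d cop) (ℕP.<⇒≤ 2^p<c^d)
    where
    open ℕP.≤-Reasoning
    2^p<c^d : 2 ^ p ℕ.< c ^ suc d
    2^p<c^d = ℕP.*-cancelʳ-< (y ^ suc d) _ _ (begin-strict
      2 ^ p ℕ.* y ^ suc d      <⟨ 2^p*y^d<x^d ⟩
      x ^ suc d                ≤⟨ ℕP.^-monoˡ-≤ (suc d) x≤y*c ⟩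
      (y ℕ.* c) ^ suc d        ≡⟨ trans (cong (_^ suc d) (ℕP.*-comm y c)) (^-distribʳ-* c y (suc d)) ⟩
      c ^ suc d ℕ.* y ^ suc d  ∎)
  Pow2<⇒≤ {mkℚ -[1+ p ] d cop} _ _ b =
    ℚP.≤-trans (ℚP.<⇒≤ (ℚP.negative⁻¹ (mkℚ -[1+ p ] d cop))) (Log₂≤⇒0≤ b)

module CodeExponent where
  open import Data.Nat using (ℕ; _∸_)
  import Data.Nat as ℕ
  open import Data.Integer using (+_)
  open import Data.Rational using (ℚ; 0ℚ; 1ℚ; ½; _/_; _+_; _*_; _-_; -_; _≤_; nonNegative)
  import Data.Rational.Properties as ℚP
  open import Data.Rational.Solver using (module +-*-Solver)
  open import Relation.Binary.PropositionalEquality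
  open CodeCounting using (codeCount)
  open NatToRational
  open Log₂Bounds

  codeExponent : (n k s : ℕ) (l a : ℚ) → ℚ
  codeExponent n k s l a =
    ℕ→ℚ k * l + (ℕ→ℚ k * ℕ→ℚ k + (ℕ→ℚ (n ∸ k) + ℕ→ℚ k * (ℕ→ℚ s * a + ℕ→ℚ (n ∸ k ∸ s))))

  Log₂≤-codeCount : ∀ {n l a} k s → Log₂≤ n l → Log₂≤ 3 a → Log₂≤ (codeCount n k s) (codeExponent n k s l a)
  Log₂≤-codeCount {n} k s log₂n≤l log₂3≤a =
    Log₂≤-* (Log₂≤-^ k log₂n≤l)
      (Log₂≤-* (Log₂≤-^ k (Log₂≤-2^ k))
        (Log₂≤-* (Log₂≤-2^ (n ∸ k)) (Log₂≤-^ k (Log₂≤-* (Log₂≤-^ s log₂3≤a) (Log₂≤-2^ (n ∸ k ∸ s))))))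

  +-nonNeg : ∀ {x y} → 0ℚ ≤ x → 0ℚ ≤ y → 0ℚ ≤ x + y
  +-nonNeg = ℚP.+-mono-≤

  *-nonNeg : ∀ {x y} → 0ℚ ≤ x → 0ℚ ≤ y → 0ℚ ≤ x * y
  *-nonNeg {x} {y} 0≤x 0≤y =
    ℚP.nonNegative⁻¹ (x * y) {{ℚP.nonNeg*nonNeg⇒nonNeg x {{nonNegative 0≤x}} y {{nonNegative 0≤y}}}}

  ≤⇒-nonNeg : ∀ {x y} → y ≤ x → 0ℚ ≤ x - y
  ≤⇒-nonNeg {x} {y} y≤x = subst (_≤ x - y) (ℚP.+-inverseʳ y) (ℚP.+-monoˡ-≤ (- y) y≤x)

  ε : ℚ
  ε = + 1 / 1000000

  codeExponent≤RHS : ∀ n k s l a → k ℕ.≤ n → s ℕ.≤ n ∸ k → ℕ→ℚ k ≤ l → 1ℚ ≤ l → 1ℚ ≤ a →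
    ℕ→ℚ s ≤ (½ - ε) * ℕ→ℚ n → codeExponent n k s l a ≤ RHS n l a
  codeExponent≤RHS n k s l a k≤n s≤n-k k≤l 1≤l 1≤a s≤[½-ε]n = begin
    codeExponent n k s l a
      ≡⟨ cong₂ (λ m m′ → K * l + (K * K + (m + K * (S * a + m′)))) (ℕ→ℚ-∸ k≤n)
               (trans (ℕ→ℚ-∸ s≤n-k) (cong (_- S) (ℕ→ℚ-∸ k≤n))) ⟩
    X
      ≤⟨ ℚP.≤-trans (ℚP.≤-reflexive (sym (ℚP.+-identityʳ X))) (ℚP.+-monoʳ-≤ X 0≤slack) ⟩
    X + slack
      ≡⟨ RHS≡X+slack ⟨
    RHS n l a
      ∎
    where
    open ℚP.≤-Reasoning
    N = ℕ→ℚ n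
    K = ℕ→ℚ k
    S = ℕ→ℚ s
    X = K * l + (K * K + ((N - K) + K * (S * a + (N - K - S))))
    -- every summand is a product of factors that are nonnegative by hypothesis
    slack = N * (l - K) + (a - 1ℚ) * ((½ - ε) * N * (l - K) + K * ((½ - ε) * N - S))
            + l * (l - K) + ½ * l * (l - 1ℚ) + K
    RHS≡X+slack : RHS n l a ≡ X + slack
    RHS≡X+slack = solve 5 (λ N K S l a →
        ((con 1ℚ :+ a) :* con ½ :+ (con 1ℚ :- a) :* con ε) :* N :* l :+ N
          :+ con (+ 3 / 2) :* l :* l :- con ½ :* l
      := K :* l :+ (K :* K :+ ((N :- K) :+ K :* (S :* a :+ (N :- K :- S))))
          :+ (N :* (l :- K) :+ (a :- con 1ℚ) :* ((con ½ :- con ε) :* N :* (l :- K) :+ K :* ((con ½ :- con ε) :* N :- S))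
              :+ l :* (l :- K) :+ con ½ :* l :* (l :- con 1ℚ) :+ K))
      refl N K S l a
      where open +-*-Solver
    0≤N = ℚP.nonNegative⁻¹ N {{ℕ→ℚ-nonNeg n}}
    0≤K = ℚP.nonNegative⁻¹ K {{ℕ→ℚ-nonNeg k}}
    0≤l = ℚP.≤-trans (ℚP.nonNegative⁻¹ 1ℚ) 1≤l
    0≤½ : 0ℚ ≤ ½
    0≤½ = ℚP.nonNegative⁻¹ ½
    0≤½-ε : 0ℚ ≤ ½ - ε
    0≤½-ε = ℚP.nonNegative⁻¹ (½ - ε)
    0≤slack : 0ℚ ≤ slack
    0≤slack =
      +-nonNeg
        (+-nonNeg
          (+-nonNeg
            (+-nonNeg (*-nonNeg 0≤N (≤⇒-nonNeg k≤l))
                      (*-nonNeg (≤⇒-nonNeg 1≤a)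
                                (+-nonNeg (*-nonNeg (*-nonNeg 0≤½-ε 0≤N) (≤⇒-nonNeg k≤l))
                                          (*-nonNeg 0≤K (≤⇒-nonNeg s≤[½-ε]n)))))
            (*-nonNeg 0≤l (≤⇒-nonNeg k≤l)))
          (*-nonNeg (*-nonNeg 0≤½ 0≤l) (≤⇒-nonNeg 1≤l)))
        0≤K

module Parameters where
  open import Data.Nat using (ℕ; zero; suc; _+_; _*_; _^_; _∸_; _≤_; _<_; z≤n; s≤s; ⌊_/2⌋; ⌈_/2⌉; _⊓_; _/_; NonZero)
  import Data.Nat.Properties as ℕP
  open import Data.Nat.DivMod using (/-monoˡ-≤; m*n/n≡m; m/n*n≤m)
  open import Data.Nat.Logarithm using (⌊log₂_⌋)
  open import Data.Nat.Logarithm.Core using (⌊log2⌋)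
  open import Data.Nat.Induction using (<-wellFounded)
  open import Induction.WellFounded using (Acc; acc)
  open import Data.Rational using (ℚ; ½; _-_)
  import Data.Rational as ℚ
  import Data.Rational.Properties as ℚP
  open import Function using (_∘_)
  open import Relation.Binary.PropositionalEquality
  open CodeCounting using (SparseBound)
  open NatToRational
  open CodeExponent using (ε)

  2^⌊log2⌋≤ : ∀ n (rec : Acc _<_ n) → 0 < n → 2 ^ ⌊log2⌋ n rec ≤ n
  2^⌊log2⌋≤ 1             _        _ = s≤s z≤n
  2^⌊log2⌋≤ (suc (suc n)) (acc rs) _ = begin
    2 * 2 ^ ⌊log2⌋ (suc ⌊ n /2⌋) _  ≤⟨ ℕP.*-monoʳ-≤ 2 (2^⌊log2⌋≤ (suc ⌊ n /2⌋) _ (s≤s z≤n)) ⟩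
    2 * suc ⌊ n /2⌋                  ≡⟨ cong (suc ⌊ n /2⌋ +_) (ℕP.+-identityʳ (suc ⌊ n /2⌋)) ⟩
    suc ⌊ n /2⌋ + suc ⌊ n /2⌋        ≡⟨ cong suc (ℕP.+-suc ⌊ n /2⌋ ⌊ n /2⌋) ⟩
    suc (suc (⌊ n /2⌋ + ⌊ n /2⌋))    ≤⟨ s≤s (s≤s (ℕP.+-monoʳ-≤ ⌊ n /2⌋ (ℕP.⌊n/2⌋≤⌈n/2⌉ n))) ⟩
    suc (suc (⌊ n /2⌋ + ⌈ n /2⌉))    ≡⟨ cong (suc ∘ suc) (ℕP.⌊n/2⌋+⌈n/2⌉≡n n) ⟩
    suc (suc n)                      ∎
    where open ℕP.≤-Reasoning

  2^⌊log₂n⌋≤n : ∀ n → 0 < n → 2 ^ ⌊log₂ n ⌋ ≤ n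
  2^⌊log₂n⌋≤n n = 2^⌊log2⌋≤ n (<-wellFounded n)

  n<2^n : ∀ n → n < 2 ^ n
  n<2^n zero    = s≤s z≤n
  n<2^n (suc n) = ℕP.+-mono-≤ (ℕP.m^n>0 2 n) (ℕP.≤-trans (n<2^n n) (ℕP.m≤m+n (2 ^ n) 0))

  2^k≤n⇒k≤n : ∀ {k n} → 2 ^ k ≤ n → k ≤ n
  2^k≤n⇒k≤n {k} 2^k≤n = ℕP.<⇒≤ (ℕP.<-≤-trans (n<2^n k) 2^k≤n)

  *≤⇒≤/ : ∀ a {j b} .{{_ : NonZero a}} → a * j ≤ b → j ≤ b / a
  *≤⇒≤/ a {j} {b} a*j≤b = subst (_≤ b / a) (m*n/n≡m j a) (/-monoˡ-≤ a (subst (_≤ b) (ℕP.*-comm a j) a*j≤b))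

  *[/]≤ : ∀ a b .{{_ : NonZero a}} → a * (b / a) ≤ b
  *[/]≤ a b = subst (_≤ b) (ℕP.*-comm (b / a) a) (m/n*n≤m b a)

  ℕ→ℚ-≤-scaled : ∀ a b {j n} (r : ℚ) → 0 < a → r ℚ.* ℕ→ℚ a ≡ ℕ→ℚ b → a * j ≤ b * n →
    ℕ→ℚ j ℚ.≤ r ℚ.* ℕ→ℚ n
  ℕ→ℚ-≤-scaled a b {j} {n} r 0<a r*a≡b a*j≤b*n = ℚP.*-cancelˡ-≤-pos (ℕ→ℚ a) {{ℕ→ℚ-pos 0<a}} (begin
    ℕ→ℚ a ℚ.* ℕ→ℚ j          ≡⟨ ℕ→ℚ-* a j ⟨
    ℕ→ℚ (a * j)              ≤⟨ ℕ→ℚ-mono-≤ a*j≤b*n ⟩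
    ℕ→ℚ (b * n)              ≡⟨ trans (ℕ→ℚ-* b n) (cong (ℚ._* ℕ→ℚ n) (sym r*a≡b)) ⟩
    r ℚ.* ℕ→ℚ a ℚ.* ℕ→ℚ n    ≡⟨ trans (cong (ℚ._* ℕ→ℚ n) (ℚP.*-comm r (ℕ→ℚ a)))
                                      (ℚP.*-assoc (ℕ→ℚ a) r (ℕ→ℚ n)) ⟩
    ℕ→ℚ a ℚ.* (r ℚ.* ℕ→ℚ n)  ∎)
    where open ℚP.≤-Reasoning

  cap : ℕ → ℕ → ℕ
  cap n k = (499999 * n / 1000000) ⊓ (n ∸ k)

  cap≤n∸k : ∀ n k → cap n k ≤ n ∸ k
  cap≤n∸k n k = ℕP.m⊓n≤n (499999 * n / 1000000) (n ∸ k)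

  sparseBound-cap : ∀ n k → SparseBound n k (cap n k)
  sparseBound-cap n k {j} j≤n-k 10⁶j≤499999n = ℕP.⊓-glb (*≤⇒≤/ 1000000 {j} {499999 * n} 10⁶j≤499999n) j≤n-k

  cap≤[½-ε]n : ∀ n k → ℕ→ℚ (cap n k) ℚ.≤ (½ - ε) ℚ.* ℕ→ℚ n
  cap≤[½-ε]n n k = ℕ→ℚ-≤-scaled 1000000 499999 {cap n k} {n} (½ - ε) (s≤s z≤n) refl
    (ℕP.≤-trans (ℕP.*-monoʳ-≤ 1000000 (ℕP.m⊓n≤m (499999 * n / 1000000) (n ∸ k))) (*[/]≤ 1000000 (499999 * n)))

open import Data.Nat using (ℕ; _≤_; _∸_; z≤n; s≤s)
import Data.Nat.Properties as ℕP
open import Data.Nat.Logarithm using (⌊log₂_⌋)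
open import Data.Product using (∃-syntax; _,_)
open CodeCounting using (#B≤#F*codeCount)
open Log₂Bounds
open CodeExponent using (Log₂≤-codeCount; codeExponent≤RHS)
open Parameters

mainTheorem8 : ∃[ N ] (∀ (n : ℕ) → N ≤ n →
    Log2RatioBound n (#B n ⌊log₂ n ⌋) (#F (n ∸ ⌊log₂ n ⌋)))
mainTheorem8 = 2 , λ n 2≤n q l a 2^q<B/F n<2^l 3<2^a →
  let k       = ⌊log₂ n ⌋
      0<n     = ℕP.≤-trans (s≤s z≤n) 2≤n
      2^k≤n   = 2^⌊log₂n⌋≤n n 0<n
      log₂n≤l = <Pow2⇒Log₂≤ 0<n n<2^l
      log₂3≤a = <Pow2⇒Log₂≤ (s≤s z≤n) 3<2^a
      exponent≤RHS = codeExponent≤RHS n k (cap n k) l a (2^k≤n⇒k≤n 2^k≤n) (cap≤n∸k n k)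
        (2^k≤c⇒k≤r k 2^k≤n log₂n≤l) (2^k≤c⇒k≤r 1 2≤n log₂n≤l) (2^k≤c⇒k≤r 1 (s≤s (s≤s z≤n)) log₂3≤a)
        (cap≤[½-ε]n n k)
  in Pow2<⇒≤ 2^q<B/F (#B≤#F*codeCount n k (cap n k) (sparseBound-cap n k))
       (Log₂≤-mono exponent≤RHS (Log₂≤-codeCount k (cap n k) log₂n≤l log₂3≤a))
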